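{- Let $n,d$ be integers with $2\le d\le n$. There exist multisets $\gamma_1,\dots,\gamma_N$ of size $2$ with elements from $[n]$ (a repeated element is allowed), with $N\le \frac{n^2}{2(d-1)}+O(n)$, such that every multiset $\alpha$ of size $d$ with elements from $[n]$ contains some $\gamma_k$ as a sub-multiset.
   Context: A multiset over $[n]$ is identified with a vector in $\mathbb{N}^n$ of multiplicities; its size is the sum of multiplicities, and $\gamma$ is a sub-multiset of $\alpha$ if $\gamma_j\le\alpha_j$ for all $j$. -}

module Defs where

open import Data.Nat using (ℕ; _+_; _≤_)
open import Data.Fin using (Fin)
import Data.Vec.Functional as VF

-- A multiset over [n] = {0,..,n-1} (Fin n), as its vector of multiplicities.
Multiset : ℕ → Set
Multiset n = Fin n → ℕ

size : ∀ {n} → Multiset n → ℕ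
size = VF.foldr _+_ 0

_⊑_ : ∀ {n} → Multiset n → Multiset n → Set
γ ⊑ α = ∀ j → γ j ≤ α j

{-# OPTIONS --safe #-}
-- Put m = d − 1, cut an interval [0, m q) ⊇ [n] into m blocks of q = ⌊n/m⌋ + 1 consecutive
-- elements, and take as the γ_k all pairs {x, y} (x = y allowed) inside a single block:
-- there are m q (q + 1)/2 ≤ n²/(2m) + 3n of them.  A multiset of size m + 1 puts, by
-- pigeonhole, two of its elements (counted with multiplicity) into one block, and these
-- two form one of the chosen pairs.
module Submission where

open import Defs
open import Data.Nat using (ℕ; zero; suc; _+_; _*_; _∸_; _^_; _≤_; _<_; z≤n; s≤s; _≤?_; _≟_; _⊓_; _/_; _%_; NonZero)
open import Data.Nat.Properties
open import Algebra.Properties.CommutativeMonoid.Sum +-0-commutativeMonoid using (∑-distrib-+; sum-replicate-zero)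
open import Data.Nat.DivMod using (m≡m%n+[m/n]*n; m%n<n; m/n*n≤m)
open import Data.Nat.Tactic.RingSolver using (solve)
open import Data.Fin using (Fin; toℕ) renaming (zero to fzero; suc to fsuc)
open import Data.List using (List; []; _∷_; _++_; map; upTo; length; lookup)
open import Data.List.Properties using (length-++; length-map; length-upTo)
open import Data.List.Membership.Propositional using (_∈_; lose)
open import Data.List.Membership.Propositional.Properties using (∈-++⁺ˡ; ∈-++⁺ʳ; ∈-map⁺; ∈-upTo⁺)
open import Data.List.Relation.Unary.Any as Any using (Any)
open import Data.List.Relation.Unary.Any.Properties using (lookup-index)
open import Data.Product as Product using (Σ; ∃; ∃₂; _×_; _,_)
open import Data.Sum using (inj₁; inj₂)
open import Function using (_∘_)
open import Relation.Nullary using (yes; no; contradiction)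
open import Relation.Binary.PropositionalEquality

sumBelow : (ℕ → ℕ) → ℕ → ℕ
sumBelow g zero = 0
sumBelow g (suc k) = g 0 + sumBelow (g ∘ suc) k

sumBelow-+ : ∀ g k l → sumBelow g (k + l) ≡ sumBelow g k + sumBelow (g ∘ (k +_)) l
sumBelow-+ g zero l = refl
sumBelow-+ g (suc k) l =
  trans (cong (g 0 +_) (sumBelow-+ (g ∘ suc) k l)) (sym (+-assoc (g 0) _ _))

sumBelow-cong : ∀ {g h} → g ≗ h → ∀ k → sumBelow g k ≡ sumBelow h k
sumBelow-cong g≗h zero = refl
sumBelow-cong g≗h (suc k) = cong₂ _+_ (g≗h 0) (sumBelow-cong (g≗h ∘ suc) k)

sumBelow-mono : ∀ g {k l} → k ≤ l → sumBelow g k ≤ sumBelow g l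
sumBelow-mono g {k} {l} k≤l = begin
  sumBelow g k                                   ≤⟨ m≤m+n _ _ ⟩
  sumBelow g k + sumBelow (g ∘ (k +_)) (l ∸ k)   ≡⟨ sumBelow-+ g k (l ∸ k) ⟨
  sumBelow g (k + (l ∸ k))                       ≡⟨ cong (sumBelow g) (m+[n∸m]≡n k≤l) ⟩
  sumBelow g l                                   ∎
  where open ≤-Reasoning

sumBelow-blocks : ∀ g q m → sumBelow g (m * q) ≡ sumBelow (λ i → sumBelow (g ∘ (i * q +_)) q) m
sumBelow-blocks g q zero = refl
sumBelow-blocks g q (suc m) = begin
  sumBelow g (q + m * q)
    ≡⟨ sumBelow-+ g q (m * q) ⟩
  sumBelow g q + sumBelow (g ∘ (q +_)) (m * q)
    ≡⟨ cong (sumBelow g q +_) (sumBelow-blocks (g ∘ (q +_)) q m) ⟩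
  sumBelow g q + sumBelow (λ i → sumBelow (g ∘ (q +_) ∘ (i * q +_)) q) m
    ≡⟨ cong (sumBelow g q +_) (sumBelow-cong (λ i → sumBelow-cong (cong g ∘ sym ∘ +-assoc q (i * q)) q) m) ⟩
  sumBelow g q + sumBelow (λ i → sumBelow (g ∘ (suc i * q +_)) q) m
    ∎
  where open ≡-Reasoning

sumBelow-tail : ∀ g k {c r} → c + r ≤ sumBelow g (suc k) → g 0 ≤ c → r ≤ sumBelow (g ∘ suc) k
sumBelow-tail g k {c} c+r≤ g0≤c =
  +-cancelˡ-≤ c _ _ (≤-trans c+r≤ (+-monoˡ-≤ (sumBelow (g ∘ suc) k) g0≤c))

pigeonhole : ∀ h m → m < sumBelow h m → ∃ λ i → i < m × 2 ≤ h i
pigeonhole h (suc m) m<sum with h 0 ≤? 1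
... | no h0≰1 = 0 , s≤s z≤n , ≰⇒> h0≰1
... | yes h0≤1 with pigeonhole (h ∘ suc) m (sumBelow-tail h m m<sum h0≤1)
...   | i , i<m , 2≤hi = suc i , s≤s i<m , 2≤hi

δ : ℕ → ℕ → ℕ
δ zero zero = 1
δ zero (suc b) = 0
δ (suc x) zero = 0
δ (suc x) (suc b) = δ x b

δ-diag : ∀ x → δ x x ≡ 1
δ-diag zero = refl
δ-diag (suc x) = δ-diag x

δ-off : ∀ {x b} → x ≢ b → δ x b ≡ 0
δ-off {zero} {zero} x≢b = contradiction refl x≢b
δ-off {zero} {suc b} x≢b = refl
δ-off {suc x} {zero} x≢b = refl
δ-off {suc x} {suc b} x≢b = δ-off (x≢b ∘ cong suc)

record HasPair (g : ℕ → ℕ) (x y : ℕ) : Set where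
  constructor hasPair
  field δ+δ≤ : ∀ b → δ x b + δ y b ≤ g b

hasPair-diag : ∀ {g x} → 2 ≤ g x → HasPair g x x
hasPair-diag {g} {x} 2≤gx = hasPair δ+δ≤
  where
  δ+δ≤ : ∀ b → δ x b + δ x b ≤ g b
  δ+δ≤ b with x ≟ b
  ... | yes refl rewrite δ-diag x = 2≤gx
  ... | no x≢b rewrite δ-off x≢b = z≤n

hasPair-distinct : ∀ {g x y} → x ≢ y → 1 ≤ g x → 1 ≤ g y → HasPair g x y
hasPair-distinct {g} {x} {y} x≢y 1≤gx 1≤gy = hasPair δ+δ≤
  where
  δ+δ≤ : ∀ b → δ x b + δ y b ≤ g b
  δ+δ≤ b with x ≟ b | y ≟ b
  ... | yes refl | yes refl = contradiction refl x≢y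
  ... | yes refl | no y≢b rewrite δ-diag x | δ-off y≢b = 1≤gx
  ... | no x≢b | yes refl rewrite δ-off x≢b | δ-diag y = 1≤gy
  ... | no x≢b | no y≢b rewrite δ-off x≢b | δ-off y≢b = z≤n

hasPair-suc : ∀ {g x y} → HasPair (g ∘ suc) x y → HasPair g (suc x) (suc y)
hasPair-suc (hasPair δ+δ≤) = hasPair λ { zero → z≤n ; (suc b) → δ+δ≤ b }

hasPair-shift : ∀ {g x y} s → HasPair (g ∘ (s +_)) x y → HasPair g (s + x) (s + y)
hasPair-shift zero p = p
hasPair-shift (suc s) p = hasPair-suc (hasPair-shift s p)

positive-in-window : ∀ g k → 1 ≤ sumBelow g k → ∃ λ y → y < k × 1 ≤ g y
positive-in-window g (suc k) 1≤sum with 1 ≤? g 0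
... | yes 1≤g0 = 0 , s≤s z≤n , 1≤g0
... | no 1≰g0 with positive-in-window (g ∘ suc) k (sumBelow-tail g k 1≤sum (≤-pred (≰⇒> 1≰g0)))
...   | y , y<k , 1≤gy = suc y , s≤s y<k , 1≤gy

pair-in-window : ∀ g k → 2 ≤ sumBelow g k → ∃₂ λ x y → x ≤ y × y < k × HasPair g x y
pair-in-window g (suc k) 2≤sum with 2 ≤? g 0 | 1 ≤? g 0
... | yes 2≤g0 | _ = 0 , 0 , z≤n , s≤s z≤n , hasPair-diag 2≤g0
... | no 2≰g0 | yes 1≤g0
  with positive-in-window (g ∘ suc) k (sumBelow-tail g k 2≤sum (≤-pred (≰⇒> 2≰g0)))
...   | y , y<k , 1≤gy = 0 , suc y , z≤n , s≤s y<k , hasPair-distinct (λ ()) 1≤g0 1≤gy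
pair-in-window g (suc k) 2≤sum | no _ | no 1≰g0
  with pair-in-window (g ∘ suc) k (sumBelow-tail g k 2≤sum (≤-pred (≰⇒> 1≰g0)))
...   | x , y , x≤y , y<k , p = suc x , suc y , s≤s x≤y , s≤s y<k , hasPair-suc p

mult : ∀ {n} → Multiset n → ℕ → ℕ
mult {zero} α a = 0
mult {suc n} α zero = α fzero
mult {suc n} α (suc a) = mult (α ∘ fsuc) a

mult-toℕ : ∀ {n} (α : Multiset n) j → mult α (toℕ j) ≡ α j
mult-toℕ α fzero = refl
mult-toℕ α (fsuc j) = mult-toℕ (α ∘ fsuc) j

mult-beyond : ∀ {n} (α : Multiset n) {a} → n ≤ a → mult α a ≡ 0
mult-beyond {zero} α n≤a = refl
mult-beyond {suc n} α (s≤s n≤a) = mult-beyond (α ∘ fsuc) n≤a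

size≡sumBelow-mult : ∀ {n} (α : Multiset n) → size α ≡ sumBelow (mult α) n
size≡sumBelow-mult {zero} α = refl
size≡sumBelow-mult {suc n} α = cong (α fzero +_) (size≡sumBelow-mult (α ∘ fsuc))

pairOf : ∀ {n} → ℕ → ℕ → Multiset n
pairOf x y j = δ x (toℕ j) + δ y (toℕ j)

size-δ : ∀ {n x} → x < n → size {n} (δ x ∘ toℕ) ≡ 1
size-δ {suc n} {zero} _ = cong suc (sum-replicate-zero n)
size-δ {suc n} {suc x} (s≤s x<n) = size-δ x<n

size-pairOf : ∀ {n x y} → x < n → y < n → size {n} (pairOf x y) ≡ 2
size-pairOf {n} {x} {y} x<n y<n =
  trans (∑-distrib-+ {n} (δ x ∘ toℕ) (δ y ∘ toℕ)) (cong₂ _+_ (size-δ x<n) (size-δ y<n))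

hasPair⇒pairOf⊑ : ∀ {n} {α : Multiset n} {x y} → HasPair (mult α) x y → pairOf x y ⊑ α
hasPair⇒pairOf⊑ {α = α} (hasPair δ+δ≤) j = subst (_ ≤_) (mult-toℕ α j) (δ+δ≤ (toℕ j))

hasPair⇒< : ∀ {n} {α : Multiset n} {x y} → HasPair (mult α) x y → x < n × y < n
hasPair⇒< {n} {α} {x} {y} (hasPair δ+δ≤) =
  below x (m+n≤o⇒m≤o (δ x x) (δ+δ≤ x)) , below y (m+n≤o⇒n≤o (δ x y) (δ+δ≤ y))
  where
  below : ∀ z → δ z z ≤ mult α z → z < n
  below z le with n ≤? z
  ... | no n≰z = ≰⇒> n≰z
  ... | yes n≤z = contradiction (subst₂ _≤_ (δ-diag z) (mult-beyond α n≤z) le) λ ()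

row : ℕ → List (ℕ × ℕ)
row y = map (_, y) (upTo (suc y))

length-row : ∀ y → length (row y) ≡ suc y
length-row y = trans (length-map (_, y) (upTo (suc y))) (length-upTo (suc y))

triangle : ℕ → List (ℕ × ℕ)
triangle zero = []
triangle (suc y) = row y ++ triangle y

∈-triangle : ∀ {x y k} → x ≤ y → y < k → (x , y) ∈ triangle k
∈-triangle {x} {y} {suc k} x≤y y<1+k with m<1+n⇒m<n∨m≡n y<1+k
... | inj₂ refl = ∈-++⁺ˡ (∈-map⁺ (_, y) (∈-upTo⁺ (s≤s x≤y)))
... | inj₁ y<k = ∈-++⁺ʳ (row k) (∈-triangle x≤y y<k)

2*length-triangle : ∀ k → 2 * length (triangle k) ≡ k * suc k
2*length-triangle zero = refl
2*length-triangle (suc k) = begin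
  2 * length (row k ++ triangle k)  ≡⟨ cong (2 *_) (trans (length-++ (row k)) (cong (_+ t) (length-row k))) ⟩
  2 * (suc k + t)                   ≡⟨ *-distribˡ-+ 2 (suc k) t ⟩
  2 * suc k + 2 * t                 ≡⟨ cong (2 * suc k +_) (2*length-triangle k) ⟩
  2 * suc k + k * suc k             ≡⟨ solve (k ∷ []) ⟩
  suc k * suc (suc k)               ∎
  where
  open ≡-Reasoning
  t = length (triangle k)

blockTriangles : ℕ → ℕ → List (ℕ × ℕ)
blockTriangles q zero = []
blockTriangles q (suc i) = map (Product.map (i * q +_) (i * q +_)) (triangle q) ++ blockTriangles q i

∈-blockTriangles : ∀ {q m i x y} → i < m → x ≤ y → y < q → (i * q + x , i * q + y) ∈ blockTriangles q m
∈-blockTriangles {q} {suc m} {i} i<1+m x≤y y<q with m<1+n⇒m<n∨m≡n i<1+m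
... | inj₂ refl = ∈-++⁺ˡ (∈-map⁺ _ (∈-triangle x≤y y<q))
... | inj₁ i<m = ∈-++⁺ʳ _ (∈-blockTriangles i<m x≤y y<q)

length-blockTriangles : ∀ q m → length (blockTriangles q m) ≡ m * length (triangle q)
length-blockTriangles q zero = refl
length-blockTriangles q (suc m) =
  trans (length-++ (map _ (triangle q)))
        (cong₂ _+_ (length-map _ (triangle q)) (length-blockTriangles q m))

-- Pairs reaching past n − 1 (only possible in the last block) are clamped into [n], so that
-- every γ_k has size 2; such pairs are never the ones that a multiset over [n] contains.
clampedPair : ∀ n' → ℕ × ℕ → Multiset (suc n')
clampedPair n' (x , y) = pairOf (x ⊓ n') (y ⊓ n')

size-clampedPair : ∀ n' z → size (clampedPair n' z) ≡ 2
size-clampedPair n' (x , y) = size-pairOf (s≤s (m⊓n≤n x n')) (s≤s (m⊓n≤n y n'))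

hasPair⇒clampedPair⊑ : ∀ {n'} {α : Multiset (suc n')} {x y} → HasPair (mult α) x y → clampedPair n' (x , y) ⊑ α
hasPair⇒clampedPair⊑ {α = α} p with x<n , y<n ← hasPair⇒< p =
  subst₂ (λ a c → pairOf a c ⊑ α) (sym (m≤n⇒m⊓n≡m (≤-pred x<n))) (sym (m≤n⇒m⊓n≡m (≤-pred y<n)))
    (hasPair⇒pairOf⊑ p)

m<blockSums : ∀ {n m q} (α : Multiset n) → size α ≡ suc m → n ≤ m * q →
              m < sumBelow (λ i → sumBelow (mult α ∘ (i * q +_)) q) m
m<blockSums {n} {m} {q} α size≡ n≤mq = begin-strict
  m                                                    <⟨ ≤-refl ⟩
  suc m                                                ≡⟨ trans (sym size≡) (size≡sumBelow-mult α) ⟩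
  sumBelow (mult α) n                                  ≤⟨ sumBelow-mono (mult α) n≤mq ⟩
  sumBelow (mult α) (m * q)                            ≡⟨ sumBelow-blocks (mult α) q m ⟩
  sumBelow (λ i → sumBelow (mult α ∘ (i * q +_)) q) m  ∎
  where open ≤-Reasoning

blockTriangles-cover : ∀ {n' m q} → suc n' ≤ m * q → (α : Multiset (suc n')) → size α ≡ suc m →
                       Any (λ z → clampedPair n' z ⊑ α) (blockTriangles q m)
blockTriangles-cover {m = m} {q} n≤mq α size≡
  with i , i<m , 2≤block ← pigeonhole _ m (m<blockSums α size≡ n≤mq)
  with x , y , x≤y , y<q , p ← pair-in-window _ q 2≤block
  = lose (∈-blockTriangles i<m x≤y y<q) (hasPair⇒clampedPair⊑ (hasPair-shift (i * q) p))

m≤n*[1+m/n] : ∀ m n .{{_ : NonZero n}} → m ≤ n * suc (m / n)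
m≤n*[1+m/n] m n = begin
  m                    ≡⟨ m≡m%n+[m/n]*n m n ⟩
  m % n + m / n * n    ≤⟨ +-monoˡ-≤ (m / n * n) (<⇒≤ (m%n<n m n)) ⟩
  n + m / n * n        ≡⟨ cong (n +_) (*-comm (m / n) n) ⟩
  n + n * (m / n)      ≡⟨ *-suc n (m / n) ⟨
  n * suc (m / n)      ∎
  where open ≤-Reasoning

n*[1+m/n]≤n+m : ∀ m n .{{_ : NonZero n}} → n * suc (m / n) ≤ n + m
n*[1+m/n]≤n+m m n = begin
  n * suc (m / n)      ≡⟨ *-suc n (m / n) ⟩
  n + n * (m / n)      ≡⟨ cong (n +_) (*-comm n (m / n)) ⟩
  n + m / n * n        ≤⟨ +-monoʳ-≤ n (m/n*n≤m m n) ⟩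
  n + m                ∎
  where open ≤-Reasoning

pairCount-bound : ∀ {n m q t} → m ≤ n → m * q ≤ m + n → 2 * t ≡ q * suc q →
                  2 * m * (m * t) ≤ n ^ 2 + 2 * m * (3 * n)
pairCount-bound {n} {m} {q} {t} m≤n mq≤m+n 2t≡ = begin
  2 * m * (m * t)                      ≡⟨ solve (m ∷ t ∷ []) ⟩
  m * m * (2 * t)                      ≡⟨ cong (m * m *_) 2t≡ ⟩
  m * m * (q * suc q)                  ≡⟨ solve (m ∷ q ∷ []) ⟩
  (m * q) * (m + m * q)                ≤⟨ *-mono-≤ mq≤m+n (+-monoʳ-≤ m mq≤m+n) ⟩
  (m + n) * (m + (m + n))              ≡⟨ solve (m ∷ n ∷ []) ⟩
  n * n + 3 * (m * n) + 2 * (m * m)    ≤⟨ +-monoʳ-≤ (n * n + 3 * (m * n)) 2mm≤3mn ⟩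
  n * n + 3 * (m * n) + 3 * (m * n)    ≡⟨ solve (m ∷ n ∷ []) ⟩
  -- n ^ 2 is stated through its unfolding, as the ring solver does not interpret _^_.
  n * (n * 1) + 2 * m * (3 * n)        ∎
  where
  open ≤-Reasoning
  2mm≤3mn : 2 * (m * m) ≤ 3 * (m * n)
  2mm≤3mn = *-mono-≤ {2} {3} (s≤s (s≤s z≤n)) (*-monoʳ-≤ m m≤n)

lemma3p15 : Σ ℕ λ C → (n d : ℕ) → 2 ≤ d → d ≤ n →
    Σ ℕ λ N → Σ (Fin N → Multiset n) λ γ →
      ((k : Fin N) → size (γ k) ≡ 2) ×
      (2 * (d ∸ 1) * N ≤ n ^ 2 + 2 * (d ∸ 1) * (C * n)) ×
      ((α : Multiset n) → size α ≡ d → ∃ λ k → γ k ⊑ α)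
lemma3p15 = 3 , λ where
  (suc n') (suc m@(suc _)) (s≤s (s≤s z≤n)) (s≤s m≤n') →
    let n = suc n'
        q = suc (n / m)
        L = blockTriangles q m
    in length L
     , clampedPair n' ∘ lookup L
     , size-clampedPair n' ∘ lookup L
     , subst (λ N → 2 * m * N ≤ n ^ 2 + 2 * m * (3 * n)) (sym (length-blockTriangles q m))
         (pairCount-bound (m≤n⇒m≤1+n m≤n') (n*[1+m/n]≤n+m n m) (2*length-triangle q))
     , λ α size≡ → let p = blockTriangles-cover (m≤n*[1+m/n] n m) α size≡
                   in Any.index p , lookup-index p
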